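{- Let $G$ be a finite directed graph and $r\in V(G)$ with positive in-degree and positive out-degree. In the algorithm ABAD (described in the context), each per-iteration estimate $\mathbf{c}_\tau$ satisfies \[ \mathrm{Var}[\mathbf{c}_\tau]=\alpha(r)\,bc(r)-bc(r)^2 . \]
   Context: $G$ is a finite, unweighted directed graph without self-loops or multiple edges, assumed (weakly) connected. For $s,t\in V(G)$, $\sigma_{st}$ is the number of shortest directed paths from $s$ to $t$ and $\sigma_{st}(v)$ the number of those passing through $v$. Betweenness centrality: $bc(r)=\frac{1}{|V(G)|(|V(G)|-1)}\sum_{s,t\in V(G)\setminus\{r\}}\frac{\sigma_{st}(r)}{\sigma_{st}}$ (terms with $\sigma_{st}=0$ counted as $0$). $\mathcal{RF}(r)$ is the set of vertices $s\ne r$ with a directed path from $s$ to $r$; $\mathcal{RT}(r)$ is the set of vertices $t\ne r$ with a directed path from $r$ to $t$. $\alpha(r)=\frac{|\mathcal{RF}(r)|\,|\mathcal{RT}(r)|}{|V(G)|(|V(G)|-1)}$. Algorithm ABAD: with $RF=\mathcal{RF}(r)$, $RT=\mathcal{RT}(r)$, in each iteration $\tau$, independently, pick $s\in RF$ and $t\in RT$ uniformly at random and independently; pick a shortest directed path $\pi$ from $s$ to $t$ uniformly at random among all shortest paths from $s$ to $t$; set $\mathbf{c}_\tau=\frac{|RF|\,|RT|}{|V(G)|(|V(G)|-1)}$ if $r$ lies on $\pi$ and $\mathbf{c}_\tau=0$ otherwise. -}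

module Defs where

open import Data.Nat using (ℕ; zero; suc; _∸_) renaming (_*_ to _*ℕ_)
open import Data.Bool using (Bool; true; false; _∧_; not; if_then_else_)
open import Data.Fin using (Fin)
open import Data.Fin.Properties using (_≟_)
open import Data.List using (List; []; _∷_; map; concatMap; allFin; filterᵇ; length; foldr)
open import Data.Integer using (+_)
open import Data.Rational using (ℚ; 0ℚ; _/_; _+_; _*_; _-_)
open import Data.Sum using (_⊎_)
open import Relation.Binary.PropositionalEquality using (_≡_)
import Data.Product
open import Data.Bool.ListAction using (any)
open import Relation.Nullary.Decidable using (⌊_⌋)

-- A finite directed graph on vertex set Fin n, given by its adjacency
-- relation E (Bool-valued, hence no multiple edges), without self-loops,
-- weakly connected.
data UWalk {n : ℕ} (E : Fin n → Fin n → Bool) : Fin n → Fin n → Set where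
  here : ∀ {u} → UWalk E u u
  step : ∀ {u w v} → (E u w ≡ true ⊎ E w u ≡ true) → UWalk E w v → UWalk E u v

record Digraph : Set where
  field
    n       : ℕ
    E       : Fin n → Fin n → Bool
    noLoops : ∀ v → E v v ≡ false
    weaklyConnected : ∀ u v → UWalk E u v

-- ℚ fraction a/b, with the convention a/0 = 0
frac : ℕ → ℕ → ℚ
frac a zero    = 0ℚ
frac a (suc b) = (+ a) / suc b

sumℚ : List ℚ → ℚ
sumℚ = foldr _+_ 0ℚ

module _ (G : Digraph) where
  open Digraph G

  _==_ : Fin n → Fin n → Bool
  i == j = ⌊ i ≟ j ⌋

  lists : ℕ → List (List (Fin n))
  lists zero    = [] ∷ []
  lists (suc k) = concatMap (λ v → map (v ∷_) (lists k)) (allFin n)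

  walkTo : Fin n → Fin n → List (Fin n) → Bool
  walkTo t x []       = x == t
  walkTo t x (y ∷ ys) = E x y ∧ walkTo t y ys

  isWalk : Fin n → Fin n → List (Fin n) → Bool
  isWalk s t []       = false
  isWalk s t (x ∷ xs) = (x == s) ∧ walkTo t x xs

  -- directed walks from s to t with exactly k edges (as vertex lists)
  walksLen : Fin n → Fin n → ℕ → List (List (Fin n))
  walksLen s t k = filterᵇ (isWalk s t) (lists (suc k))

  search : Fin n → Fin n → ℕ → ℕ → List (List (Fin n))
  search s t zero     k = []
  search s t (suc f)  k with walksLen s t k
  ... | []     = search s t f (suc k)
  ... | p ∷ ps = p ∷ ps

  -- all shortest directed paths from s to t (empty if t unreachable from s).
  -- Lengths 0 .. n-1 suffice since shortest walks are simple paths.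
  SP : Fin n → Fin n → List (List (Fin n))
  SP s t = search s t n 0

  σ : Fin n → Fin n → ℕ
  σ s t = length (SP s t)

  onPath : Fin n → List (Fin n) → Bool
  onPath v π = any (_== v) π

  σthrough : Fin n → Fin n → Fin n → ℕ
  σthrough s t v = length (filterᵇ (onPath v) (SP s t))

  reaches : Fin n → Fin n → Bool
  reaches s t = not (isEmpty (SP s t))
    where
      isEmpty : List (List (Fin n)) → Bool
      isEmpty []      = true
      isEmpty (_ ∷ _) = false

  RF : Fin n → List (Fin n)
  RF r = filterᵇ (λ s → not (s == r) ∧ reaches s r) (allFin n)

  RT : Fin n → List (Fin n)
  RT r = filterᵇ (λ t → not (t == r) ∧ reaches r t) (allFin n)

  N : ℕ
  N = n *ℕ (n ∸ 1)

  bc : Fin n → ℚ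
  bc r = frac 1 N * sumℚ (map (λ s → sumℚ (map (λ t → frac (σthrough s t r) (σ s t))
                            (others r))) (others r))
    where
      others : Fin n → List (Fin n)
      others r = filterᵇ (λ v → not (v == r)) (allFin n)

  α : Fin n → ℚ
  α r = frac (length (RF r) *ℕ length (RT r)) N

  -- ABAD, one iteration: outcome (s , t , π) with s ∈ RF uniform, t ∈ RT uniform,
  -- π uniform among shortest s→t paths; probability 1/(|RF|·|RT|·σ_st).
  E[_] : Fin n → (Fin n → Fin n → List (Fin n) → ℚ) → ℚ
  E[ r ] f = sumℚ (map (λ s → sumℚ (map (λ t → sumℚ (map (λ π →
               frac 1 (length (RF r) *ℕ length (RT r) *ℕ σ s t) * f s t π)
               (SP s t))) (RT r))) (RF r))

  c : Fin n → Fin n → Fin n → List (Fin n) → ℚ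
  c r s t π = if onPath r π then frac (length (RF r) *ℕ length (RT r)) N else 0ℚ

  Var : Fin n → ℚ
  Var r = E[ r ] (λ s t π → (c r s t π - E[ r ] (c r)) * (c r s t π - E[ r ] (c r)))

  InDegPos OutDegPos : Fin n → Set
  InDegPos  r = Data.Product.∃ λ u → E u r ≡ true
  OutDegPos r = Data.Product.∃ λ v → E r v ≡ true

module Submission where

-- One iteration of ABAD draws the outcome (s, t, π) with probability 1/(|RF| |RT| σ_st), and c only
-- takes the values 0 and α(r); hence c² = α(r) c and Var[c] = α(r) E[c] - E[c]² as soon as the
-- weights sum to 1. They do: the degree hypotheses make RF and RT nonempty, and every s ∈ RF reaches
-- every t ∈ RT through r, so σ_st > 0. Finally E[c] = bc(r): the outcome (s, t, ·) contributes
-- σ_st(r)/σ_st / (n(n-1)) in total, and no shortest path between a pair outside RF × RT meets r.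

open import Defs
open import Data.Fin using (Fin)
open import Data.Rational using (_*_; _-_)
open import Relation.Binary.PropositionalEquality using (_≡_)

open import Data.Bool using (Bool; true; false; T; not; _∧_; if_then_else_)
open import Data.Bool.Properties using (T-∧; T-≡; T-not-≡)
open import Data.Fin.Properties using (_≟_; pigeonhole)
import Data.Fin as Fin
import Data.Integer as ℤ
import Data.Integer.Properties as ℤ
open import Data.Integer.Tactic.RingSolver using (solve-∀)
open import Data.List using (List; []; _∷_; _++_; map; length; lookup; allFin; filterᵇ)
open import Data.List.Membership.Propositional using (_∈_)
open import Data.List.Membership.Propositional.Properties using (∈-filter⁺; ∈-filter⁻; ∈-allFin; ∈-concatMap⁺; ∈-map⁺; ∈-lookup)
open import Data.List.Properties using (filter-none)
import Data.List.Relation.Unary.All as All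
open import Data.List.Relation.Unary.All.Properties using (¬Any⇒All¬)
open import Data.List.Relation.Unary.Any as Any using (here; there)
open import Data.List.Relation.Unary.Any.Properties using (any⁻)
open import Data.List.Relation.Unary.AllPairs using ([]; _∷_)
open import Data.List.Relation.Unary.Unique.Propositional using (Unique)
open import Data.Nat as ℕ using (ℕ; zero; suc; NonZero; _≤_; _<_; z≤n; s≤s)
import Data.Nat.Properties as ℕ
open import Data.Product using (∃; _×_; _,_; proj₁; proj₂)
open import Data.Sum using (inj₁; inj₂)
open import Data.Rational using (ℚ; 0ℚ; 1ℚ; _+_; _/_; toℚᵘ)
open import Data.Rational.Properties using (toℚᵘ-injective; toℚᵘ-homo-+; toℚᵘ-homo-*; toℚᵘ-fromℚᵘ; 0/n≡0; *-identityˡ; *-identityʳ; *-zeroˡ; *-zeroʳ; +-identityˡ)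
open import Data.Rational.Solver using (module +-*-Solver)
open import Data.Rational.Unnormalised as ℚᵘ using (mkℚᵘ; *≡*) renaming (_≃_ to _≃ᵘ_)
import Data.Rational.Unnormalised.Properties as ℚᵘ
open import Function using (_∘_; Equivalence)
open import Relation.Binary.PropositionalEquality using (_≢_; refl; sym; trans; cong; cong₂; subst; module ≡-Reasoning)
open import Relation.Nullary using (¬_; yes; no; contradiction)
open import Relation.Nullary.Decidable using (toWitness; fromWitness; fromWitnessFalse; T?)

open +-*-Solver

fromℕ : ℕ → ℚ
fromℕ k = ℤ.+ k / 1

toℚᵘ-/ : ∀ i d → toℚᵘ (i / suc d) ≃ᵘ mkℚᵘ i d
toℚᵘ-/ i d = toℚᵘ-fromℚᵘ (mkℚᵘ i d)

fromℕ-homo-+ : ∀ a b → fromℕ (a ℕ.+ b) ≡ fromℕ a + fromℕ b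
fromℕ-homo-+ a b = toℚᵘ-injective (begin
  toℚᵘ (fromℕ (a ℕ.+ b))                ≈⟨ toℚᵘ-/ (ℤ.+ (a ℕ.+ b)) 0 ⟩
  mkℚᵘ (ℤ.+ (a ℕ.+ b)) 0                ≈⟨ *≡* (trans (cong (ℤ._* ℤ.1ℤ) (ℤ.pos-+ a b)) (+-over-1 (ℤ.+ a) (ℤ.+ b))) ⟩
  mkℚᵘ (ℤ.+ a) 0 ℚᵘ.+ mkℚᵘ (ℤ.+ b) 0    ≈⟨ ℚᵘ.+-cong (toℚᵘ-/ (ℤ.+ a) 0) (toℚᵘ-/ (ℤ.+ b) 0) ⟨
  toℚᵘ (fromℕ a) ℚᵘ.+ toℚᵘ (fromℕ b)    ≈⟨ toℚᵘ-homo-+ (fromℕ a) (fromℕ b) ⟨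
  toℚᵘ (fromℕ a + fromℕ b)              ∎)
  where
  open ℚᵘ.≃-Reasoning
  +-over-1 : ∀ x y → (x ℤ.+ y) ℤ.* ℤ.1ℤ ≡ (x ℤ.* ℤ.1ℤ ℤ.+ y ℤ.* ℤ.1ℤ) ℤ.* ℤ.1ℤ
  +-over-1 = solve-∀

fromℕ-homo-* : ∀ a b → fromℕ (a ℕ.* b) ≡ fromℕ a * fromℕ b
fromℕ-homo-* a b = toℚᵘ-injective (begin
  toℚᵘ (fromℕ (a ℕ.* b))                ≈⟨ toℚᵘ-/ (ℤ.+ (a ℕ.* b)) 0 ⟩
  mkℚᵘ (ℤ.+ (a ℕ.* b)) 0                ≈⟨ *≡* (cong (ℤ._* ℤ.1ℤ) (ℤ.pos-* a b)) ⟩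
  mkℚᵘ (ℤ.+ a) 0 ℚᵘ.* mkℚᵘ (ℤ.+ b) 0    ≈⟨ ℚᵘ.*-cong (toℚᵘ-/ (ℤ.+ a) 0) (toℚᵘ-/ (ℤ.+ b) 0) ⟨
  toℚᵘ (fromℕ a) ℚᵘ.* toℚᵘ (fromℕ b)    ≈⟨ toℚᵘ-homo-* (fromℕ a) (fromℕ b) ⟨
  toℚᵘ (fromℕ a * fromℕ b)              ∎)
  where open ℚᵘ.≃-Reasoning

frac-*-denominator : ∀ a d .{{_ : NonZero d}} → frac a d * fromℕ d ≡ fromℕ a
frac-*-denominator a (suc d) = toℚᵘ-injective (begin
  toℚᵘ (frac a (suc d) * fromℕ (suc d))             ≈⟨ toℚᵘ-homo-* (frac a (suc d)) (fromℕ (suc d)) ⟩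
  toℚᵘ (frac a (suc d)) ℚᵘ.* toℚᵘ (fromℕ (suc d))   ≈⟨ ℚᵘ.*-cong (toℚᵘ-/ (ℤ.+ a) d) (toℚᵘ-/ (ℤ.+ suc d) 0) ⟩
  mkℚᵘ (ℤ.+ a) d ℚᵘ.* mkℚᵘ (ℤ.+ suc d) 0            ≈⟨ *≡* (cancel (ℤ.+ a) (ℤ.+ suc d)) ⟩
  mkℚᵘ (ℤ.+ a) 0                                    ≈⟨ toℚᵘ-/ (ℤ.+ a) 0 ⟨
  toℚᵘ (fromℕ a)                                    ∎)
  where
  open ℚᵘ.≃-Reasoning
  cancel : ∀ x y → (x ℤ.* y) ℤ.* ℤ.1ℤ ≡ x ℤ.* (y ℤ.* ℤ.1ℤ)
  cancel = solve-∀

frac1-inverse : ∀ d .{{_ : NonZero d}} → frac 1 d * fromℕ d ≡ 1ℚ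
frac1-inverse d = frac-*-denominator 1 d

frac-zero : ∀ d → frac 0 d ≡ 0ℚ
frac-zero zero    = refl
frac-zero (suc d) = 0/n≡0 (suc d)

frac≡fromℕ*frac1 : ∀ a d → frac a d ≡ fromℕ a * frac 1 d
frac≡fromℕ*frac1 a zero      = sym (*-zeroʳ (fromℕ a))
frac≡fromℕ*frac1 a d@(suc _) = begin
  frac a d                          ≡⟨ *-identityʳ (frac a d) ⟨
  frac a d * 1ℚ                     ≡⟨ cong (frac a d *_) (frac1-inverse d) ⟨
  frac a d * (frac 1 d * fromℕ d)   ≡⟨ solve 3 (λ x y z → x :* (y :* z) := (x :* z) :* y) refl (frac a d) (frac 1 d) (fromℕ d) ⟩
  (frac a d * fromℕ d) * frac 1 d   ≡⟨ cong (_* frac 1 d) (frac-*-denominator a d) ⟩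
  fromℕ a * frac 1 d                ∎
  where open ≡-Reasoning

frac1-* : ∀ x y → frac 1 (x ℕ.* y) ≡ frac 1 x * frac 1 y
frac1-* zero      y                         = sym (*-zeroˡ (frac 1 y))
frac1-* x@(suc _) zero rewrite ℕ.*-zeroʳ x = sym (*-zeroʳ (frac 1 x))
frac1-* x@(suc _) y@(suc _) = begin
  frac 1 xy                                             ≡⟨ *-identityʳ _ ⟨
  frac 1 xy * (1ℚ * 1ℚ)                                 ≡⟨ cong (frac 1 xy *_) (cong₂ _*_ (frac1-inverse x) (frac1-inverse y)) ⟨
  frac 1 xy * ((frac 1 x * fromℕ x) * (frac 1 y * fromℕ y))
    ≡⟨ solve 5 (λ p a b c d → p :* ((a :* b) :* (c :* d)) := (p :* (b :* d)) :* (a :* c))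
               refl (frac 1 xy) (frac 1 x) (fromℕ x) (frac 1 y) (fromℕ y) ⟩
  (frac 1 xy * (fromℕ x * fromℕ y)) * (frac 1 x * frac 1 y)
    ≡⟨ cong (λ z → (frac 1 xy * z) * (frac 1 x * frac 1 y)) (fromℕ-homo-* x y) ⟨
  (frac 1 xy * fromℕ xy) * (frac 1 x * frac 1 y)        ≡⟨ cong (_* (frac 1 x * frac 1 y)) (frac1-inverse xy) ⟩
  1ℚ * (frac 1 x * frac 1 y)                            ≡⟨ *-identityˡ _ ⟩
  frac 1 x * frac 1 y                                   ∎
  where
  open ≡-Reasoning
  xy = x ℕ.* y

T-not⇒¬T : ∀ {b} → T (not b) → ¬ T b
T-not⇒¬T {false} _ ()

∈⇒length-nonZero : ∀ {X : Set} {x : X} {xs} → x ∈ xs → NonZero (length xs)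
∈⇒length-nonZero {xs = _ ∷ _} _ = _

module _ {X : Set} where

  ∑ : List X → (X → ℚ) → ℚ
  ∑ xs f = sumℚ (map f xs)

  ∑-cong : ∀ xs {f g : X → ℚ} → (∀ x → x ∈ xs → f x ≡ g x) → ∑ xs f ≡ ∑ xs g
  ∑-cong []       eq = refl
  ∑-cong (x ∷ xs) eq = cong₂ _+_ (eq x (here refl)) (∑-cong xs (λ y y∈ → eq y (there y∈)))

  ∑-+ : ∀ xs (f g : X → ℚ) → ∑ xs (λ x → f x + g x) ≡ ∑ xs f + ∑ xs g
  ∑-+ []       f g = refl
  ∑-+ (x ∷ xs) f g = trans (cong ((f x + g x) +_) (∑-+ xs f g))
    (solve 4 (λ a b c d → (a :+ b) :+ (c :+ d) := (a :+ c) :+ (b :+ d)) refl (f x) (g x) (∑ xs f) (∑ xs g))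

  ∑-*ˡ : ∀ xs a (f : X → ℚ) → ∑ xs (λ x → a * f x) ≡ a * ∑ xs f
  ∑-*ˡ []       a f = sym (*-zeroʳ a)
  ∑-*ˡ (x ∷ xs) a f = trans (cong (a * f x +_) (∑-*ˡ xs a f))
    (solve 3 (λ a b c → a :* b :+ a :* c := a :* (b :+ c)) refl a (f x) (∑ xs f))

  ∑-linear : ∀ xs a b (f g : X → ℚ) → ∑ xs (λ x → a * f x + b * g x) ≡ a * ∑ xs f + b * ∑ xs g
  ∑-linear xs a b f g = trans (∑-+ xs _ _) (cong₂ _+_ (∑-*ˡ xs a f) (∑-*ˡ xs b g))

  ∑-const : ∀ xs a → ∑ xs (λ _ → a) ≡ fromℕ (length xs) * a
  ∑-const []       a = sym (*-zeroˡ a)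
  ∑-const (x ∷ xs) a = begin
    a + ∑ xs (λ _ → a)                ≡⟨ cong (a +_) (∑-const xs a) ⟩
    a + fromℕ (length xs) * a         ≡⟨ solve 2 (λ a m → a :+ m :* a := (con 1ℚ :+ m) :* a) refl a (fromℕ (length xs)) ⟩
    (1ℚ + fromℕ (length xs)) * a      ≡⟨ cong (_* a) (fromℕ-homo-+ 1 (length xs)) ⟨
    fromℕ (suc (length xs)) * a       ∎
    where open ≡-Reasoning

  ∑-zero : ∀ xs {f : X → ℚ} → (∀ x → x ∈ xs → f x ≡ 0ℚ) → ∑ xs f ≡ 0ℚ
  ∑-zero xs eq = trans (∑-cong xs eq) (trans (∑-const xs 0ℚ) (*-zeroʳ (fromℕ (length xs))))

  ∑-filterᵇ : ∀ (p : X → Bool) xs f → ∑ (filterᵇ p xs) f ≡ ∑ xs (λ x → if p x then f x else 0ℚ)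
  ∑-filterᵇ p []       f = refl
  ∑-filterᵇ p (x ∷ xs) f with p x
  ... | true  = cong (f x +_) (∑-filterᵇ p xs f)
  ... | false = trans (∑-filterᵇ p xs f) (sym (+-identityˡ _))

  ∑-filterᵇ-∧ : ∀ (p q : X → Bool) xs f → (∀ x → T (not (q x)) → f x ≡ 0ℚ) →
                ∑ (filterᵇ (λ x → p x ∧ q x) xs) f ≡ ∑ (filterᵇ p xs) f
  ∑-filterᵇ-∧ p q []       f vanish = refl
  ∑-filterᵇ-∧ p q (x ∷ xs) f vanish with p x | q x in qx
  ... | false | _     = ∑-filterᵇ-∧ p q xs f vanish
  ... | true  | true  = cong (f x +_) (∑-filterᵇ-∧ p q xs f vanish)
  ... | true  | false = begin
    ∑ (filterᵇ (λ x → p x ∧ q x) xs) f      ≡⟨ ∑-filterᵇ-∧ p q xs f vanish ⟩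
    ∑ (filterᵇ p xs) f                      ≡⟨ +-identityˡ _ ⟨
    0ℚ + ∑ (filterᵇ p xs) f                 ≡⟨ cong (_+ ∑ (filterᵇ p xs) f) (vanish x (Equivalence.from T-not-≡ qx)) ⟨
    f x + ∑ (filterᵇ p xs) f                ∎
    where open ≡-Reasoning

module Walks (G : Digraph) where
  open Digraph G using (n; E)
  open import Data.List.Membership.DecPropositional (_≟_ {n}) using (_∈?_)

  data Walk : Fin n → Fin n → List (Fin n) → Set where
    []  : ∀ {t} → Walk t t []
    _∷_ : ∀ {x y t ys} → T (E x y) → Walk y t ys → Walk x t (y ∷ ys)

  Reachable : Fin n → Fin n → Set
  Reachable s t = ∃ (Walk s t)

  ==⇒≡ : ∀ {x y} → T (_==_ G x y) → x ≡ y
  ==⇒≡ {x} {y} = toWitness {a? = x ≟ y}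

  ==-refl : ∀ x → T (_==_ G x x)
  ==-refl x = fromWitness {a? = x ≟ x} refl

  walkTo⇒Walk : ∀ {t} x ys → T (walkTo G t x ys) → Walk x t ys
  walkTo⇒Walk x [] x≡t with ==⇒≡ x≡t
  ... | refl = []
  walkTo⇒Walk x (y ∷ ys) w =
    let e , w′ = Equivalence.to T-∧ w in e ∷ walkTo⇒Walk y ys w′

  Walk⇒walkTo : ∀ {x t ys} → Walk x t ys → T (walkTo G t x ys)
  Walk⇒walkTo {x} []      = ==-refl x
  Walk⇒walkTo     (e ∷ w) = Equivalence.from T-∧ (e , Walk⇒walkTo w)

  isWalk⇒Walk : ∀ {s t} x ys → T (isWalk G s t (x ∷ ys)) → x ≡ s × Walk x t ys
  isWalk⇒Walk x ys w = let x≡s , w′ = Equivalence.to T-∧ w in ==⇒≡ x≡s , walkTo⇒Walk x ys w′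

  Walk⇒isWalk : ∀ {s t ys} → Walk s t ys → T (isWalk G s t (s ∷ ys))
  Walk⇒isWalk {s} w = Equivalence.from T-∧ (==-refl s , Walk⇒walkTo w)

  Walk-++ : ∀ {x r t ys zs} → Walk x r ys → Walk r t zs → Walk x t (ys ++ zs)
  Walk-++ []      w′ = w′
  Walk-++ (e ∷ w) w′ = e ∷ Walk-++ w w′

  Walk-split : ∀ {x r t ys} → Walk x t ys → r ∈ x ∷ ys → Reachable x r × Reachable r t
  Walk-split w       (here refl) = ([] , []) , (_ , w)
  Walk-split (e ∷ w) (there r∈)  = let (_ , w₁) , w₂ = Walk-split w r∈ in (_ , e ∷ w₁) , w₂

  Reachable-trans : ∀ {s r t} → Reachable s r → Reachable r t → Reachable s t
  Reachable-trans (_ , w) (_ , w′) = _ , Walk-++ w w′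

  loopErase-suffix : ∀ {x y t ys} → x ∈ y ∷ ys → Walk y t ys → Unique (y ∷ ys) →
                     ∃ λ zs → Walk x t zs × Unique (x ∷ zs)
  loopErase-suffix (here refl) w       u       = _ , w , u
  loopErase-suffix (there x∈)  (_ ∷ w) (_ ∷ u) = loopErase-suffix x∈ w u

  loopErase : ∀ {x t ys} → Walk x t ys → ∃ λ zs → Walk x t zs × Unique (x ∷ zs)
  loopErase [] = [] , [] , All.[] ∷ []
  loopErase {x} (e ∷ w) with loopErase w
  ... | zs , w′ , u with x ∈? (_ ∷ zs)
  ...   | yes x∈ = loopErase-suffix x∈ w′ u
  ...   | no  x∉ = _ ∷ zs , e ∷ w′ , ¬Any⇒All¬ _ x∉ ∷ u

  Unique-lookup-injective : ∀ {xs : List (Fin n)} → Unique xs → ∀ {i j} → i Fin.< j → lookup xs i ≢ lookup xs j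
  Unique-lookup-injective (x≢ ∷ u) {Fin.zero}  {Fin.suc j} _         eq = All.lookup x≢ (∈-lookup j) eq
  Unique-lookup-injective (x≢ ∷ u) {Fin.suc i} {Fin.suc j} (s≤s i<j) eq = Unique-lookup-injective u i<j eq

  Unique⇒length≤n : ∀ {xs : List (Fin n)} → Unique xs → length xs ≤ n
  Unique⇒length≤n {xs} u with length xs ℕ.≤? n
  ... | yes le = le
  ... | no  gt =
    let i , j , i<j , eq = pigeonhole (ℕ.≰⇒> gt) (lookup xs) in
    contradiction eq (Unique-lookup-injective u i<j)

  ∈-lists : ∀ xs → xs ∈ lists G (length xs)
  ∈-lists []       = here refl
  ∈-lists (x ∷ xs) = ∈-concatMap⁺ (λ v → map (v ∷_) (lists G (length xs)))
    (Any.map (λ { refl → ∈-map⁺ (x ∷_) (∈-lists xs) }) (∈-allFin x))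

  module _ (s t : Fin n) where

    search-sound : ∀ fuel k {π} → π ∈ search G s t fuel k → T (isWalk G s t π)
    search-sound (suc fuel) k {π} π∈ with walksLen G s t k in eq
    ... | []    = search-sound fuel (suc k) π∈
    ... | _ ∷ _ = proj₂ (∈-filter⁻ (T? ∘ isWalk G s t) {xs = lists G (suc k)} (subst (π ∈_) (sym eq) π∈))

    search-complete : ∀ fuel k₀ k {π} → π ∈ walksLen G s t k → k₀ ≤ k → k < k₀ ℕ.+ fuel →
                      ∃ (_∈ search G s t fuel k₀)
    search-complete zero k₀ k _ k₀≤k k<k₀ = contradiction (subst (k <_) (ℕ.+-identityʳ k₀) k<k₀) (ℕ.≤⇒≯ k₀≤k)
    search-complete (suc fuel) k₀ k π∈ k₀≤k k< with walksLen G s t k₀ in eq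
    ... | π′ ∷ _ = π′ , here refl
    ... | []     with ℕ.m≤n⇒m<n∨m≡n k₀≤k
    ...   | inj₁ k₀<k = search-complete fuel (suc k₀) k π∈ k₀<k (subst (k <_) (ℕ.+-suc k₀ fuel) k<)
    ...   | inj₂ refl = contradiction (subst (_ ∈_) eq π∈) λ ()

    ∈SP⇒reaches : ∀ {π} → π ∈ SP G s t → T (reaches G s t)
    ∈SP⇒reaches π∈ with SP G s t
    ... | _ ∷ _ = _

    ∈-walksLen : ∀ {ys} → Walk s t ys → s ∷ ys ∈ walksLen G s t (length ys)
    ∈-walksLen {ys} w = ∈-filter⁺ (T? ∘ isWalk G s t) (∈-lists (s ∷ ys)) (Walk⇒isWalk w)

    -- A loop-erased walk has fewer than n edges, so the bounded search in SP finds one.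
    Reachable⇒reaches : Reachable s t → T (reaches G s t)
    Reachable⇒reaches (_ , w) =
      let zs , w′ , u = loopErase w
          _ , π∈ = search-complete n 0 (length zs) (∈-walksLen w′) z≤n (Unique⇒length≤n u)
      in ∈SP⇒reaches π∈

    ∈SP⇒Walk : ∀ {π} → π ∈ SP G s t → ∃ λ ys → π ≡ s ∷ ys × Walk s t ys
    ∈SP⇒Walk {[]}     π∈ with search-sound n 0 π∈
    ... | ()
    ∈SP⇒Walk {x ∷ ys} π∈ with isWalk⇒Walk x ys (search-sound n 0 π∈)
    ... | refl , w = ys , refl , w

    reaches⇒Reachable : T (reaches G s t) → Reachable s t
    reaches⇒Reachable s⇝t with SP G s t in eq
    ... | π ∷ _ with ∈SP⇒Walk (subst (π ∈_) (sym eq) (here refl))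
    ...   | ys , _ , w = ys , w

    reaches⇒σ-nonZero : T (reaches G s t) → NonZero (σ G s t)
    reaches⇒σ-nonZero s⇝t with SP G s t
    ... | _ ∷ _ = _

  through⇒reaches : ∀ {s t r π} → π ∈ SP G s t → T (onPath G r π) → T (reaches G s r) × T (reaches G r t)
  through⇒reaches {s} {t} {r} π∈ onπ with ∈SP⇒Walk s t π∈
  ... | ys , refl , w with Walk-split w (Any.map (sym ∘ ==⇒≡) (any⁻ (λ v → _==_ G v r) _ onπ))
  ...   | s⇝r , r⇝t = Reachable⇒reaches s r s⇝r , Reachable⇒reaches r t r⇝t

  reaches-trans : ∀ {s r t} → T (reaches G s r) → T (reaches G r t) → T (reaches G s t)
  reaches-trans {s} {r} {t} s⇝r r⇝t =
    Reachable⇒reaches s t (Reachable-trans (reaches⇒Reachable s r s⇝r) (reaches⇒Reachable r t r⇝t))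

  edge⇒reaches : ∀ {u v} → T (E u v) → T (reaches G u v)
  edge⇒reaches {u} {v} e = Reachable⇒reaches u v (_ , e ∷ [])

module Sampling (G : Digraph) (r : Fin (Digraph.n G)) where
  open Digraph G using (n; E; noLoops)
  open Walks G

  #RF #RT : ℕ
  #RF = length (RF G r)
  #RT = length (RT G r)

  RandomVariable : Set
  RandomVariable = Fin n → Fin n → List (Fin n) → ℚ

  weight : Fin n → Fin n → ℚ
  weight s t = frac 1 (#RF ℕ.* #RT ℕ.* σ G s t)

  𝔼 : RandomVariable → ℚ
  𝔼 = E[_] G r

  E-cong : ∀ {f g : RandomVariable} → (∀ s t π → f s t π ≡ g s t π) → 𝔼 f ≡ 𝔼 g
  E-cong eq = ∑-cong (RF G r) λ s _ → ∑-cong (RT G r) λ t _ → ∑-cong (SP G s t) λ π _ →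
    cong (weight s t *_) (eq s t π)

  E-linear : ∀ a b (f g : RandomVariable) → 𝔼 (λ s t π → a * f s t π + b * g s t π) ≡ a * 𝔼 f + b * 𝔼 g
  E-linear a b f g = begin
    𝔼 (λ s t π → a * f s t π + b * g s t π)
      ≡⟨ ∑-cong (RF G r) (λ s _ → ∑-cong (RT G r) λ t _ → along-SP s t) ⟩
    ∑ (RF G r) (λ s → ∑ (RT G r) λ t → a * along f s t + b * along g s t)
      ≡⟨ ∑-cong (RF G r) (λ s _ → ∑-linear (RT G r) a b (along f s) (along g s)) ⟩
    ∑ (RF G r) (λ s → a * ∑ (RT G r) (along f s) + b * ∑ (RT G r) (along g s))
      ≡⟨ ∑-linear (RF G r) a b _ _ ⟩
    a * 𝔼 f + b * 𝔼 g ∎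
    where
    open ≡-Reasoning
    along : RandomVariable → Fin n → Fin n → ℚ
    along h s t = ∑ (SP G s t) (λ π → weight s t * h s t π)
    along-SP : ∀ s t → along (λ s t π → a * f s t π + b * g s t π) s t ≡ a * along f s t + b * along g s t
    along-SP s t = trans
      (∑-cong (SP G s t) λ π _ → solve 5 (λ w a b x y → w :* (a :* x :+ b :* y) := a :* (w :* x) :+ b :* (w :* y))
                                         refl (weight s t) a b (f s t π) (g s t π))
      (∑-linear (SP G s t) a b _ _)

  isRF isRT : Fin n → Bool
  isRF s = not (_==_ G s r) ∧ reaches G s r
  isRT t = not (_==_ G t r) ∧ reaches G r t

  ∈RF⇒reaches : ∀ {s} → s ∈ RF G r → T (reaches G s r)
  ∈RF⇒reaches s∈ = proj₂ (Equivalence.to T-∧ (proj₂ (∈-filter⁻ (T? ∘ isRF) {xs = allFin n} s∈)))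

  ∈RT⇒reaches : ∀ {t} → t ∈ RT G r → T (reaches G r t)
  ∈RT⇒reaches t∈ = proj₂ (Equivalence.to T-∧ (proj₂ (∈-filter⁻ (T? ∘ isRT) {xs = allFin n} t∈)))

  edge⇒≢ : ∀ {u v} → T (E u v) → u ≢ v
  edge⇒≢ {u} e refl = subst T (noLoops u) e

  RF-nonZero : InDegPos G r → NonZero #RF
  RF-nonZero (u , e) = ∈⇒length-nonZero (∈-filter⁺ (T? ∘ isRF) (∈-allFin u)
    (Equivalence.from T-∧ (fromWitnessFalse {a? = u ≟ r} (edge⇒≢ u→r) , edge⇒reaches u→r)))
    where u→r = Equivalence.from T-≡ e

  RT-nonZero : OutDegPos G r → NonZero #RT
  RT-nonZero (v , e) = ∈⇒length-nonZero (∈-filter⁺ (T? ∘ isRT) (∈-allFin v)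
    (Equivalence.from T-∧ (fromWitnessFalse {a? = v ≟ r} (edge⇒≢ r→v ∘ sym) , edge⇒reaches r→v)))
    where r→v = Equivalence.from T-≡ e

  σ-nonZero : ∀ {s t} → s ∈ RF G r → t ∈ RT G r → NonZero (σ G s t)
  σ-nonZero {s} {t} s∈ t∈ = reaches⇒σ-nonZero s t (reaches-trans (∈RF⇒reaches s∈) (∈RT⇒reaches t∈))

  ∑SP-weight : ∀ {s t} → s ∈ RF G r → t ∈ RT G r → ∑ (SP G s t) (λ _ → weight s t * 1ℚ) ≡ frac 1 (#RF ℕ.* #RT)
  ∑SP-weight {s} {t} s∈ t∈ = begin
    ∑ (SP G s t) (λ _ → weight s t * 1ℚ)               ≡⟨ ∑-const (SP G s t) _ ⟩
    fromℕ σst * (frac 1 (D ℕ.* σst) * 1ℚ)              ≡⟨ cong (λ x → fromℕ σst * (x * 1ℚ)) (frac1-* D σst) ⟩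
    fromℕ σst * ((frac 1 D * frac 1 σst) * 1ℚ)         ≡⟨ solve 3 (λ m d i → m :* ((d :* i) :* con 1ℚ) := d :* (i :* m)) refl (fromℕ σst) (frac 1 D) (frac 1 σst) ⟩
    frac 1 D * (frac 1 σst * fromℕ σst)                ≡⟨ cong (frac 1 D *_) (frac1-inverse σst {{σ-nonZero s∈ t∈}}) ⟩
    frac 1 D * 1ℚ                                      ≡⟨ *-identityʳ _ ⟩
    frac 1 D                                           ∎
    where
    open ≡-Reasoning
    D = #RF ℕ.* #RT
    σst = σ G s t

  E[1]≡1 : .{{_ : NonZero #RF}} .{{_ : NonZero #RT}} → 𝔼 (λ _ _ _ → 1ℚ) ≡ 1ℚ
  E[1]≡1 = begin
    𝔼 (λ _ _ _ → 1ℚ)                              ≡⟨ ∑-cong (RF G r) (λ s s∈ → ∑-cong (RT G r) λ t t∈ → ∑SP-weight s∈ t∈) ⟩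
    ∑ (RF G r) (λ _ → ∑ (RT G r) λ _ → frac 1 D)  ≡⟨ ∑-cong (RF G r) (λ _ _ → ∑-const (RT G r) _) ⟩
    ∑ (RF G r) (λ _ → fromℕ #RT * frac 1 D)       ≡⟨ ∑-const (RF G r) _ ⟩
    fromℕ #RF * (fromℕ #RT * frac 1 D)            ≡⟨ solve 3 (λ a b i → a :* (b :* i) := i :* (a :* b)) refl (fromℕ #RF) (fromℕ #RT) (frac 1 D) ⟩
    frac 1 D * (fromℕ #RF * fromℕ #RT)            ≡⟨ cong (frac 1 D *_) (fromℕ-homo-* #RF #RT) ⟨
    frac 1 D * fromℕ D                            ≡⟨ frac1-inverse D {{ℕ.m*n≢0 #RF #RT}} ⟩
    1ℚ                                            ∎
    where
    open ≡-Reasoning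
    D = #RF ℕ.* #RT

  δ : Fin n → Fin n → ℚ
  δ s t = frac (σthrough G s t r) (σ G s t)

  δ-vanishes : ∀ {s t} → (∀ {π} → π ∈ SP G s t → ¬ T (onPath G r π)) → δ s t ≡ 0ℚ
  δ-vanishes {s} {t} avoid =
    trans (cong (λ ps → frac (length ps) (σ G s t)) (filter-none (T? ∘ onPath G r) (All.tabulate avoid)))
          (frac-zero (σ G s t))

  δ-vanishesˡ : ∀ {s t} → T (not (reaches G s r)) → δ s t ≡ 0ℚ
  δ-vanishesˡ s↛r = δ-vanishes λ π∈ through → T-not⇒¬T s↛r (proj₁ (through⇒reaches π∈ through))

  δ-vanishesʳ : ∀ {s t} → T (not (reaches G r t)) → δ s t ≡ 0ℚ
  δ-vanishesʳ r↛t = δ-vanishes λ π∈ through → T-not⇒¬T r↛t (proj₂ (through⇒reaches π∈ through))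

  ∑SP-weight*c : ∀ {s t} → s ∈ RF G r → t ∈ RT G r → ∑ (SP G s t) (λ π → weight s t * c G r s t π) ≡ frac 1 (N G) * δ s t
  ∑SP-weight*c {s} {t} s∈ t∈ = begin
    ∑ (SP G s t) (λ π → weight s t * c G r s t π)       ≡⟨ ∑-*ˡ (SP G s t) (weight s t) (c G r s t) ⟩
    weight s t * ∑ (SP G s t) (c G r s t)               ≡⟨ cong (weight s t *_) (∑-filterᵇ (onPath G r) (SP G s t) (λ _ → α G r)) ⟨
    weight s t * ∑ through (λ _ → α G r)                ≡⟨ cong (weight s t *_) (∑-const through (α G r)) ⟩
    weight s t * (fromℕ k * α G r)                      ≡⟨ cong₂ (λ w a → w * (fromℕ k * a)) (frac1-* D (σ G s t)) (frac≡fromℕ*frac1 D (N G)) ⟩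
    (frac 1 D * frac 1 (σ G s t)) * (fromℕ k * (fromℕ D * frac 1 (N G)))
      ≡⟨ solve 5 (λ iD iσ k d iN → (iD :* iσ) :* (k :* (d :* iN)) := (iD :* d) :* (iN :* (k :* iσ)))
               refl (frac 1 D) (frac 1 (σ G s t)) (fromℕ k) (fromℕ D) (frac 1 (N G)) ⟩
    (frac 1 D * fromℕ D) * (frac 1 (N G) * (fromℕ k * frac 1 (σ G s t)))
      ≡⟨ cong₂ _*_ (frac1-inverse D {{ℕ.m*n≢0 #RF #RT {{∈⇒length-nonZero s∈}} {{∈⇒length-nonZero t∈}}}})
                   (cong (frac 1 (N G) *_) (sym (frac≡fromℕ*frac1 k (σ G s t)))) ⟩
    1ℚ * (frac 1 (N G) * δ s t)                         ≡⟨ *-identityˡ _ ⟩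
    frac 1 (N G) * δ s t                                ∎
    where
    open ≡-Reasoning
    D = #RF ℕ.* #RT
    through = filterᵇ (onPath G r) (SP G s t)
    k = length through

  ≢r : Fin n → Bool
  ≢r v = not (_==_ G v r)

  others : List (Fin n)
  others = filterᵇ ≢r (allFin n)

  ∑RF∑RT≡∑others∑others : ∑ (RF G r) (λ s → ∑ (RT G r) (δ s)) ≡ ∑ others (λ s → ∑ others (δ s))
  ∑RF∑RT≡∑others∑others = trans
    (∑-cong (RF G r) λ s _ → ∑-filterᵇ-∧ ≢r (reaches G r) (allFin n) (δ s) (λ _ → δ-vanishesʳ))
    (∑-filterᵇ-∧ ≢r (λ s → reaches G s r) (allFin n) _ λ _ s↛r → ∑-zero others λ _ _ → δ-vanishesˡ s↛r)

  E[c]≡bc : 𝔼 (c G r) ≡ bc G r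
  E[c]≡bc = begin
    𝔼 (c G r)                                                 ≡⟨ ∑-cong (RF G r) (λ s s∈ → ∑-cong (RT G r) λ t t∈ → ∑SP-weight*c s∈ t∈) ⟩
    ∑ (RF G r) (λ s → ∑ (RT G r) λ t → frac 1 (N G) * δ s t)  ≡⟨ ∑-cong (RF G r) (λ s _ → ∑-*ˡ (RT G r) (frac 1 (N G)) (δ s)) ⟩
    ∑ (RF G r) (λ s → frac 1 (N G) * ∑ (RT G r) (δ s))        ≡⟨ ∑-*ˡ (RF G r) (frac 1 (N G)) _ ⟩
    frac 1 (N G) * ∑ (RF G r) (λ s → ∑ (RT G r) (δ s))        ≡⟨ cong (frac 1 (N G) *_) ∑RF∑RT≡∑others∑others ⟩
    bc G r                                                    ∎
    where open ≡-Reasoning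

  centred-square : ∀ μ s t π → (c G r s t π - μ) * (c G r s t π - μ) ≡ (α G r - (μ + μ)) * c G r s t π + (μ * μ) * 1ℚ
  centred-square μ s t π with onPath G r π
  ... | true  = solve 2 (λ a m → (a :- m) :* (a :- m) := (a :- (m :+ m)) :* a :+ (m :* m) :* con 1ℚ) refl (α G r) μ
  ... | false = solve 2 (λ a m → (con 0ℚ :- m) :* (con 0ℚ :- m) := (a :- (m :+ m)) :* con 0ℚ :+ (m :* m) :* con 1ℚ) refl (α G r) μ

  Var≡α*E[c]-E[c]² : 𝔼 (λ _ _ _ → 1ℚ) ≡ 1ℚ → Var G r ≡ α G r * 𝔼 (c G r) - 𝔼 (c G r) * 𝔼 (c G r)
  Var≡α*E[c]-E[c]² total-mass = begin
    Var G r                                                        ≡⟨ E-cong (centred-square μ) ⟩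
    𝔼 (λ s t π → (α G r - (μ + μ)) * c G r s t π + (μ * μ) * 1ℚ)   ≡⟨ E-linear (α G r - (μ + μ)) (μ * μ) (c G r) (λ _ _ _ → 1ℚ) ⟩
    (α G r - (μ + μ)) * μ + (μ * μ) * 𝔼 (λ _ _ _ → 1ℚ)             ≡⟨ cong ((α G r - (μ + μ)) * μ +_) (cong (μ * μ *_) total-mass) ⟩
    (α G r - (μ + μ)) * μ + (μ * μ) * 1ℚ                           ≡⟨ solve 2 (λ a m → (a :- (m :+ m)) :* m :+ (m :* m) :* con 1ℚ := a :* m :- m :* m) refl (α G r) μ ⟩
    α G r * μ - μ * μ                                              ∎
    where
    open ≡-Reasoning
    μ = 𝔼 (c G r)

lemma4p6 : (G : Digraph) (r : Fin (Digraph.n G)) → InDegPos G r → OutDegPos G r → Var G r ≡ α G r * bc G r - bc G r * bc G r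
lemma4p6 G r in-edge out-edge = begin
  Var G r                                      ≡⟨ Var≡α*E[c]-E[c]² (E[1]≡1 {{RF-nonZero in-edge}} {{RT-nonZero out-edge}}) ⟩
  α G r * 𝔼 (c G r) - 𝔼 (c G r) * 𝔼 (c G r)   ≡⟨ cong (λ μ → α G r * μ - μ * μ) E[c]≡bc ⟩
  α G r * bc G r - bc G r * bc G r             ∎
  where
  open Sampling G r
  open ≡-Reasoning
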